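{- Let $n\ge1$, let $F(n)$ be the free five-valued Nelson algebra with set of free generators $G$, let $f\colon G\to C_5$, let $\bar f\colon F(n)\to C_5$ be the unique homomorphism extending $f$, and let $P_f=\{x\in F(n):\bar f(x)=1\}$. Then for each $2\le i\le 5$, the subalgebra of $C_5$ generated by $\bar f(G)$ is isomorphic to $C_i$ if and only if $F(n)/P_f\cong C_i$.
   Context: A Nelson algebra is an algebra $(N,1,\sim,\wedge,\vee,\to)$ of type $(0,1,2,2,2)$ satisfying, for all $x,y,z$: $x\wedge(x\vee y)=x$; $x\wedge(y\vee z)=(z\wedge x)\vee(y\wedge x)$; $\sim\sim x=x$; $\sim(x\vee y)=\sim x\vee\sim y$; $x\wedge\sim x=(x\wedge\sim x)\wedge(y\vee\sim y)$; $x\to x=1$; $x\to(y\to z)=(x\wedge y)\to z$; $x\wedge(x\to y)=x\wedge(\sim x\vee y)$. It is five-valued if it satisfies $((x\to z)\to y)\to(((y\to x)\to y)\to y)=1$. $F(n)$ is the free algebra on $n$ free generators in the variety of five-valued Nelson algebras. For a deductive system $D$ (a set containing $1$ closed under: $x,x\to y\in D\Rightarrow y\in D$), $x\equiv_D y$ iff $x\to y,\ y\to x,\ \sim x\to\sim y,\ \sim y\to\sim x\in D$ is a congruence and $N/D$ is the quotient. For $n\ge2$, $C_n=\{\tfrac{j}{n-1}:0\le j\le n-1\}$ is the chain with min/max, $\sim x=1-x$, and $x\to y=1$ if $x\le y$ or $x\le\sim x$, and $x\to y=\sim x\vee y$ otherwise. -}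

module Defs where

open import Data.Nat using (ℕ; zero; suc; _≤_; _≤?_; _*_)
open import Data.Fin using (Fin; toℕ; fromℕ; opposite)
open import Data.Product using (Σ; _×_; _,_)
open import Data.Sum using (_⊎_)
open import Relation.Nullary using (yes; no)
open import Relation.Binary.PropositionalEquality using (_≡_)
open import Function.Bundles using (_⇔_)

-- The chain C_i, represented with carrier Fin (suc m) where i = suc m:
-- the element j : Fin (suc m) stands for j/m.

module Chain (m : ℕ) where
  Carrier : Set
  Carrier = Fin (suc m)

  top : Carrier
  top = fromℕ m

  neg : Carrier → Carrier
  neg = opposite

  meet : Carrier → Carrier → Carrier
  meet x y with toℕ x ≤? toℕ y
  ... | yes _ = x
  ... | no  _ = y

  join : Carrier → Carrier → Carrier
  join x y with toℕ x ≤? toℕ y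
  ... | yes _ = y
  ... | no  _ = x

  imp : Carrier → Carrier → Carrier
  imp x y with toℕ x ≤? toℕ y | toℕ x ≤? toℕ (neg x)
  ... | yes _ | _     = top
  ... | no _  | yes _ = top
  ... | no _  | no _  = join (neg x) y

module C5 = Chain 4

infixr 6 _∧'_ _∨'_
infixr 5 _⇒_

data Term (n : ℕ) : Set where
  var  : Fin n → Term n
  one  : Term n
  ∼_   : Term n → Term n
  _∧'_ : Term n → Term n → Term n
  _∨'_ : Term n → Term n → Term n
  _⇒_  : Term n → Term n → Term n

-- Equational theory of five-valued Nelson algebras: F(n) is the setoid
-- (Term n , _≈_), i.e. terms modulo this fully invariant congruence.
infix 4 _≈_
data _≈_ {n : ℕ} : Term n → Term n → Set where
  ≈refl  : ∀ {x} → x ≈ x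
  ≈sym   : ∀ {x y} → x ≈ y → y ≈ x
  ≈trans : ∀ {x y z} → x ≈ y → y ≈ z → x ≈ z
  ≈neg   : ∀ {x x'} → x ≈ x' → ∼ x ≈ ∼ x'
  ≈meet  : ∀ {x x' y y'} → x ≈ x' → y ≈ y' → x ∧' y ≈ x' ∧' y'
  ≈join  : ∀ {x x' y y'} → x ≈ x' → y ≈ y' → x ∨' y ≈ x' ∨' y'
  ≈imp   : ∀ {x x' y y'} → x ≈ x' → y ≈ y' → (x ⇒ y) ≈ (x' ⇒ y')
  ax1 : ∀ x y → x ∧' (x ∨' y) ≈ x
  ax2 : ∀ x y z → x ∧' (y ∨' z) ≈ (z ∧' x) ∨' (y ∧' x)
  ax3 : ∀ x → ∼ (∼ x) ≈ x
  ax4 : ∀ x y → ∼ (x ∧' y) ≈ (∼ x) ∨' (∼ y)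
  ax5 : ∀ x y → x ∧' (∼ x) ≈ (x ∧' (∼ x)) ∧' (y ∨' (∼ y))
  ax6 : ∀ x → (x ⇒ x) ≈ one
  ax7 : ∀ x y z → (x ⇒ (y ⇒ z)) ≈ ((x ∧' y) ⇒ z)
  ax8 : ∀ x y → x ∧' (x ⇒ y) ≈ x ∧' ((∼ x) ∨' y)
  ax5v : ∀ x y z →
    (((x ⇒ z) ⇒ y) ⇒ (((y ⇒ x) ⇒ y) ⇒ y)) ≈ one

ext : ∀ {n} → (Fin n → C5.Carrier) → Term n → C5.Carrier
ext f (var g)  = f g
ext f one      = C5.top
ext f (∼ x)    = C5.neg (ext f x)
ext f (x ∧' y) = C5.meet (ext f x) (ext f y)
ext f (x ∨' y) = C5.join (ext f x) (ext f y)
ext f (x ⇒ y)  = C5.imp (ext f x) (ext f y)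

P : ∀ {n} → (Fin n → C5.Carrier) → Term n → Set
P f x = ext f x ≡ C5.top

_≡[_]_ : ∀ {n} → Term n → (Fin n → C5.Carrier) → Term n → Set
x ≡[ f ] y = P f (x ⇒ y) × P f (y ⇒ x) × P f ((∼ x) ⇒ (∼ y)) × P f ((∼ y) ⇒ (∼ x))

-- F(n)/P_f ≅ C_{suc m}: an isomorphism from the quotient is given by a map
-- h on F(n) (respecting ≈) whose kernel is exactly ≡_{P_f}, which is onto
-- and preserves the operations.
QuotIso : ∀ {n} → (Fin n → C5.Carrier) → (m : ℕ) → Set
QuotIso {n} f m = Σ (Term n → Chain.Carrier m) λ h →
    (∀ x y → x ≈ y → h x ≡ h y)
  × (∀ x y → (x ≡[ f ] y) ⇔ (h x ≡ h y))
  × (∀ c → Σ (Term n) λ x → h x ≡ c)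
  × (h one ≡ Chain.top m)
  × (∀ x → h (∼ x) ≡ Chain.neg m (h x))
  × (∀ x y → h (x ∧' y) ≡ Chain.meet m (h x) (h y))
  × (∀ x y → h (x ∨' y) ≡ Chain.join m (h x) (h y))
  × (∀ x y → h (x ⇒ y) ≡ Chain.imp m (h x) (h y))

data Gen {n : ℕ} (f : Fin n → C5.Carrier) : C5.Carrier → Set where
  gvar  : ∀ g → Gen f (f g)
  gone  : Gen f C5.top
  gneg  : ∀ {a} → Gen f a → Gen f (C5.neg a)
  gmeet : ∀ {a b} → Gen f a → Gen f b → Gen f (C5.meet a b)
  gjoin : ∀ {a b} → Gen f a → Gen f b → Gen f (C5.join a b)
  gimp  : ∀ {a b} → Gen f a → Gen f b → Gen f (C5.imp a b)

-- The generated subalgebra is isomorphic to C_{suc m}: there is an injective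
-- homomorphism g : C_{suc m} → C_5 whose image is exactly Gen f.
SubIso : ∀ {n} → (Fin n → C5.Carrier) → (m : ℕ) → Set
SubIso f m = Σ (Chain.Carrier m → C5.Carrier) λ g →
    (∀ a b → g a ≡ g b → a ≡ b)
  × (∀ y → Gen f y ⇔ Σ (Chain.Carrier m) λ a → g a ≡ y)
  × (g (Chain.top m) ≡ C5.top)
  × (∀ a → g (Chain.neg m a) ≡ C5.neg (g a))
  × (∀ a b → g (Chain.meet m a b) ≡ C5.meet (g a) (g b))
  × (∀ a b → g (Chain.join m a b) ≡ C5.join (g a) (g b))
  × (∀ a b → g (Chain.imp m a b) ≡ C5.imp (g a) (g b))

-- In C₅ the four implications defining ≡_{P_f} all take the value 1 only
-- between equal elements, so ≡_{P_f} is exactly the kernel of f̄, and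
-- F(n)/P_f is isomorphic to the image f̄(F(n)), which is the subalgebra
-- generated by f(G).  Both sides of the equivalence therefore say that one
-- and the same algebra is isomorphic to C_i.
module Submission where

open import Defs
open import Data.Nat using (ℕ; _≤_; _∸_)
open import Data.Fin using (Fin)
open import Data.Fin.Properties using (all?; _≟_)
open import Data.Product using (∃; _×_; _,_; proj₁; proj₂)
open import Function.Base using (_∘_)
open import Function.Bundles using (_⇔_; mk⇔; Equivalence)
open import Function.Construct.Composition using (_⇔-∘_)
open import Function.Construct.Symmetry using (⇔-sym)
open import Algebra.Morphism.Definitions using (Homomorphic₀; Homomorphic₁; Homomorphic₂)
open import Relation.Nullary.Decidable using (from-yes; _→-dec_)
open import Relation.Binary.PropositionalEquality
  using (_≡_; refl; sym; trans; cong; cong₂; subst; module ≡-Reasoning)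

open Equivalence using (to; from)

record RawNelsonAlgebra : Set₁ where
  field
    Carrier : Set
    top     : Carrier
    neg     : Carrier → Carrier
    meet    : Carrier → Carrier → Carrier
    join    : Carrier → Carrier → Carrier
    imp     : Carrier → Carrier → Carrier

open RawNelsonAlgebra using (Carrier)

termAlgebra : ℕ → RawNelsonAlgebra
termAlgebra n = record
  { Carrier = Term n ; top = one ; neg = ∼_ ; meet = _∧'_ ; join = _∨'_ ; imp = _⇒_ }

chain : ℕ → RawNelsonAlgebra
chain m = record
  { Carrier = C.Carrier ; top = C.top ; neg = C.neg ; meet = C.meet ; join = C.join ; imp = C.imp }
  where module C = Chain m

-- A product rather than a record, so that it is definitionally the last five
-- components of SubIso and QuotIso.
IsNelsonHomomorphism : (A B : RawNelsonAlgebra) → (Carrier A → Carrier B) → Set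
IsNelsonHomomorphism A B h =
    Homomorphic₀ A.Carrier B.Carrier _≡_ h A.top B.top
  × Homomorphic₁ A.Carrier B.Carrier _≡_ h A.neg B.neg
  × Homomorphic₂ A.Carrier B.Carrier _≡_ h A.meet B.meet
  × Homomorphic₂ A.Carrier B.Carrier _≡_ h A.join B.join
  × Homomorphic₂ A.Carrier B.Carrier _≡_ h A.imp B.imp
  where
  module A = RawNelsonAlgebra A
  module B = RawNelsonAlgebra B

module Factorisation {A B C : RawNelsonAlgebra}
  {h : Carrier A → Carrier B} {g : Carrier B → Carrier C} {e : Carrier A → Carrier C}
  (g∘h≗e : ∀ x → g (h x) ≡ e x) where

  private
    module A = RawNelsonAlgebra A
    module B = RawNelsonAlgebra B
    module C = RawNelsonAlgebra C
    open ≡-Reasoning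

  module Injective (g-injective : ∀ b b′ → g b ≡ g b′ → b ≡ b′) where

    kernel : ∀ x y → h x ≡ h y ⇔ e x ≡ e y
    kernel x y = mk⇔
      (λ hx≡hy → trans (sym (g∘h≗e x)) (trans (cong g hx≡hy) (g∘h≗e y)))
      (λ ex≡ey → g-injective _ _ (trans (g∘h≗e x) (trans ex≡ey (sym (g∘h≗e y)))))

    isNelsonHomomorphism : IsNelsonHomomorphism A C e → IsNelsonHomomorphism B C g
                         → IsNelsonHomomorphism A B h
    isNelsonHomomorphism (e-top , e-neg , e-meet , e-join , e-imp)
                         (g-top , g-neg , g-meet , g-join , g-imp) =
      ( g-injective _ _ (trans (g∘h≗e A.top) (trans e-top (sym g-top)))
      , homomorphic₁ A.neg B.neg C.neg e-neg g-neg
      , homomorphic₂ A.meet B.meet C.meet e-meet g-meet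
      , homomorphic₂ A.join B.join C.join e-join g-join
      , homomorphic₂ A.imp B.imp C.imp e-imp g-imp )
      where
      homomorphic₁ : ∀ ∙A ∙B ∙C → (∀ x → e (∙A x) ≡ ∙C (e x)) → (∀ b → g (∙B b) ≡ ∙C (g b))
                   → ∀ x → h (∙A x) ≡ ∙B (h x)
      homomorphic₁ ∙A ∙B ∙C e-∙ g-∙ x = g-injective _ _ (begin
        g (h (∙A x))  ≡⟨ g∘h≗e (∙A x) ⟩
        e (∙A x)      ≡⟨ e-∙ x ⟩
        ∙C (e x)      ≡⟨ cong ∙C (g∘h≗e x) ⟨
        ∙C (g (h x))  ≡⟨ g-∙ (h x) ⟨
        g (∙B (h x))  ∎)

      homomorphic₂ : ∀ ∙A ∙B ∙C → (∀ x y → e (∙A x y) ≡ ∙C (e x) (e y))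
                   → (∀ b b′ → g (∙B b b′) ≡ ∙C (g b) (g b′))
                   → ∀ x y → h (∙A x y) ≡ ∙B (h x) (h y)
      homomorphic₂ ∙A ∙B ∙C e-∙ g-∙ x y = g-injective _ _ (begin
        g (h (∙A x y))          ≡⟨ g∘h≗e (∙A x y) ⟩
        e (∙A x y)              ≡⟨ e-∙ x y ⟩
        ∙C (e x) (e y)          ≡⟨ cong₂ ∙C (g∘h≗e x) (g∘h≗e y) ⟨
        ∙C (g (h x)) (g (h y))  ≡⟨ g-∙ (h x) (h y) ⟨
        g (∙B (h x) (h y))      ∎)

  module Surjective (section : Carrier B → Carrier A) (h∘section : ∀ b → h (section b) ≡ b) where

    isNelsonHomomorphism : IsNelsonHomomorphism A C e → IsNelsonHomomorphism A B h
                         → IsNelsonHomomorphism B C g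
    isNelsonHomomorphism (e-top , e-neg , e-meet , e-join , e-imp)
                         (h-top , h-neg , h-meet , h-join , h-imp) =
      ( trans (cong g (sym h-top)) (trans (g∘h≗e A.top) e-top)
      , homomorphic₁ A.neg B.neg C.neg e-neg h-neg
      , homomorphic₂ A.meet B.meet C.meet e-meet h-meet
      , homomorphic₂ A.join B.join C.join e-join h-join
      , homomorphic₂ A.imp B.imp C.imp e-imp h-imp )
      where
      homomorphic₁ : ∀ ∙A ∙B ∙C → (∀ x → e (∙A x) ≡ ∙C (e x)) → (∀ x → h (∙A x) ≡ ∙B (h x))
                   → ∀ b → g (∙B b) ≡ ∙C (g b)
      homomorphic₁ ∙A ∙B ∙C e-∙ h-∙ b = begin
        g (∙B b)        ≡⟨ cong (g ∘ ∙B) (h∘section b) ⟨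
        g (∙B (h x))    ≡⟨ cong g (h-∙ x) ⟨
        g (h (∙A x))    ≡⟨ g∘h≗e (∙A x) ⟩
        e (∙A x)        ≡⟨ e-∙ x ⟩
        ∙C (e x)        ≡⟨ cong ∙C (g∘h≗e x) ⟨
        ∙C (g (h x))    ≡⟨ cong (∙C ∘ g) (h∘section b) ⟩
        ∙C (g b)        ∎
        where x = section b

      homomorphic₂ : ∀ ∙A ∙B ∙C → (∀ x y → e (∙A x y) ≡ ∙C (e x) (e y))
                   → (∀ x y → h (∙A x y) ≡ ∙B (h x) (h y))
                   → ∀ b b′ → g (∙B b b′) ≡ ∙C (g b) (g b′)
      homomorphic₂ ∙A ∙B ∙C e-∙ h-∙ b b′ = begin
        g (∙B b b′)               ≡⟨ cong₂ (λ c c′ → g (∙B c c′)) (h∘section b) (h∘section b′) ⟨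
        g (∙B (h x) (h y))        ≡⟨ cong g (h-∙ x y) ⟨
        g (h (∙A x y))            ≡⟨ g∘h≗e (∙A x y) ⟩
        e (∙A x y)                ≡⟨ e-∙ x y ⟩
        ∙C (e x) (e y)            ≡⟨ cong₂ ∙C (g∘h≗e x) (g∘h≗e y) ⟨
        ∙C (g (h x)) (g (h y))    ≡⟨ cong₂ (λ c c′ → ∙C (g c) (g c′)) (h∘section b) (h∘section b′) ⟩
        ∙C (g b) (g b′)           ∎
        where x = section b ; y = section b′

module C5-Properties where
  open C5

  meet-absorbs-join : ∀ a b → meet a (join a b) ≡ a
  meet-absorbs-join = from-yes (all? λ a → all? λ b → meet a (join a b) ≟ a)

  meet-distribˡ-join : ∀ a b c → meet a (join b c) ≡ join (meet c a) (meet b a)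
  meet-distribˡ-join = from-yes (all? λ a → all? λ b → all? λ c →
    meet a (join b c) ≟ join (meet c a) (meet b a))

  neg-involutive : ∀ a → neg (neg a) ≡ a
  neg-involutive = from-yes (all? λ a → neg (neg a) ≟ a)

  neg-meet : ∀ a b → neg (meet a b) ≡ join (neg a) (neg b)
  neg-meet = from-yes (all? λ a → all? λ b → neg (meet a b) ≟ join (neg a) (neg b))

  kleene : ∀ a b → meet a (neg a) ≡ meet (meet a (neg a)) (join b (neg b))
  kleene = from-yes (all? λ a → all? λ b →
    meet a (neg a) ≟ meet (meet a (neg a)) (join b (neg b)))

  imp-refl : ∀ a → imp a a ≡ top
  imp-refl = from-yes (all? λ a → imp a a ≟ top)

  imp-curry : ∀ a b c → imp a (imp b c) ≡ imp (meet a b) c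
  imp-curry = from-yes (all? λ a → all? λ b → all? λ c → imp a (imp b c) ≟ imp (meet a b) c)

  meet-imp : ∀ a b → meet a (imp a b) ≡ meet a (join (neg a) b)
  meet-imp = from-yes (all? λ a → all? λ b → meet a (imp a b) ≟ meet a (join (neg a) b))

  five-valued : ∀ a b c → imp (imp (imp a c) b) (imp (imp (imp b a) b) b) ≡ top
  five-valued = from-yes (all? λ a → all? λ b → all? λ c →
    imp (imp (imp a c) b) (imp (imp (imp b a) b) b) ≟ top)

  imps-top⇒≡ : ∀ a b → imp a b ≡ top → imp b a ≡ top
             → imp (neg a) (neg b) ≡ top → imp (neg b) (neg a) ≡ top → a ≡ b
  imps-top⇒≡ = from-yes (all? λ a → all? λ b →
    (imp a b ≟ top) →-dec (imp b a ≟ top) →-dec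
    (imp (neg a) (neg b) ≟ top) →-dec (imp (neg b) (neg a) ≟ top) →-dec (a ≟ b))

  ≡⇒imp-top : ∀ {a b} → a ≡ b → imp a b ≡ top
  ≡⇒imp-top {a} refl = imp-refl a

module _ {n : ℕ} (f : Fin n → C5.Carrier) where

  ext-sound : ∀ {x y : Term n} → x ≈ y → ext f x ≡ ext f y
  ext-sound ≈refl         = refl
  ext-sound (≈sym p)      = sym (ext-sound p)
  ext-sound (≈trans p q)  = trans (ext-sound p) (ext-sound q)
  ext-sound (≈neg p)      = cong C5.neg (ext-sound p)
  ext-sound (≈meet p q)   = cong₂ C5.meet (ext-sound p) (ext-sound q)
  ext-sound (≈join p q)   = cong₂ C5.join (ext-sound p) (ext-sound q)
  ext-sound (≈imp p q)    = cong₂ C5.imp (ext-sound p) (ext-sound q)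
  ext-sound (ax1 x y)     = C5-Properties.meet-absorbs-join (ext f x) (ext f y)
  ext-sound (ax2 x y z)   = C5-Properties.meet-distribˡ-join (ext f x) (ext f y) (ext f z)
  ext-sound (ax3 x)       = C5-Properties.neg-involutive (ext f x)
  ext-sound (ax4 x y)     = C5-Properties.neg-meet (ext f x) (ext f y)
  ext-sound (ax5 x y)     = C5-Properties.kleene (ext f x) (ext f y)
  ext-sound (ax6 x)       = C5-Properties.imp-refl (ext f x)
  ext-sound (ax7 x y z)   = C5-Properties.imp-curry (ext f x) (ext f y) (ext f z)
  ext-sound (ax8 x y)     = C5-Properties.meet-imp (ext f x) (ext f y)
  ext-sound (ax5v x y z)  = C5-Properties.five-valued (ext f x) (ext f y) (ext f z)

  ext-isNelsonHomomorphism : IsNelsonHomomorphism (termAlgebra n) (chain 4) (ext f)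
  ext-isNelsonHomomorphism = refl , (λ _ → refl) , (λ _ _ → refl) , (λ _ _ → refl) , (λ _ _ → refl)

  ≡[]⇔ext≡ : ∀ x y → (x ≡[ f ] y) ⇔ (ext f x ≡ ext f y)
  ≡[]⇔ext≡ x y = mk⇔
    (λ (p , q , r , s) → C5-Properties.imps-top⇒≡ (ext f x) (ext f y) p q r s)
    (λ e → C5-Properties.≡⇒imp-top e , C5-Properties.≡⇒imp-top (sym e)
         , C5-Properties.≡⇒imp-top (cong C5.neg e) , C5-Properties.≡⇒imp-top (cong C5.neg (sym e)))

  ext∈Gen : ∀ t → Gen f (ext f t)
  ext∈Gen (var g)  = gvar g
  ext∈Gen one      = gone
  ext∈Gen (∼ t)    = gneg (ext∈Gen t)
  ext∈Gen (t ∧' u) = gmeet (ext∈Gen t) (ext∈Gen u)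
  ext∈Gen (t ∨' u) = gjoin (ext∈Gen t) (ext∈Gen u)
  ext∈Gen (t ⇒ u)  = gimp (ext∈Gen t) (ext∈Gen u)

  Gen⇒ext-image : ∀ {y} → Gen f y → ∃ λ t → ext f t ≡ y
  Gen⇒ext-image (gvar g)    = var g , refl
  Gen⇒ext-image gone        = one , refl
  Gen⇒ext-image (gneg p)
    with t , refl ← Gen⇒ext-image p = ∼ t , refl
  Gen⇒ext-image (gmeet p q)
    with t , refl ← Gen⇒ext-image p | u , refl ← Gen⇒ext-image q = t ∧' u , refl
  Gen⇒ext-image (gjoin p q)
    with t , refl ← Gen⇒ext-image p | u , refl ← Gen⇒ext-image q = t ∨' u , refl
  Gen⇒ext-image (gimp p q)
    with t , refl ← Gen⇒ext-image p | u , refl ← Gen⇒ext-image q = (t ⇒ u) , refl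

  module _ (m : ℕ) where

    subIso⇒quotIso : SubIso f m → QuotIso f m
    subIso⇒quotIso (g , g-injective , image , g-hom) = h , h-resp , h-kernel , h-surjective , h-hom
      where
      preimage : ∀ t → ∃ λ c → g c ≡ ext f t
      preimage t = to (image (ext f t)) (ext∈Gen t)

      h : Term n → Chain.Carrier m
      h t = proj₁ (preimage t)

      open Factorisation {termAlgebra n} {chain m} {chain 4} {h} {g} (proj₂ ∘ preimage)
      open Injective g-injective

      h-resp : ∀ x y → x ≈ y → h x ≡ h y
      h-resp x y = from (kernel x y) ∘ ext-sound

      h-kernel : ∀ x y → (x ≡[ f ] y) ⇔ (h x ≡ h y)
      h-kernel x y = ⇔-sym (kernel x y) ⇔-∘ ≡[]⇔ext≡ x y

      h-surjective : ∀ c → ∃ λ t → h t ≡ c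
      h-surjective c with t , ext-t≡g-c ← Gen⇒ext-image (from (image (g c)) (c , refl)) =
        t , g-injective _ _ (trans (proj₂ (preimage t)) ext-t≡g-c)

      h-hom : IsNelsonHomomorphism (termAlgebra n) (chain m) h
      h-hom = isNelsonHomomorphism ext-isNelsonHomomorphism g-hom

    quotIso⇒subIso : QuotIso f m → SubIso f m
    quotIso⇒subIso (h , _ , h-kernel , h-surjective , h-hom) = g , g-injective , image , g-hom
      where
      section : Chain.Carrier m → Term n
      section c = proj₁ (h-surjective c)

      h∘section : ∀ c → h (section c) ≡ c
      h∘section c = proj₂ (h-surjective c)

      h≡⇔ext≡ : ∀ x y → h x ≡ h y ⇔ ext f x ≡ ext f y
      h≡⇔ext≡ x y = ≡[]⇔ext≡ x y ⇔-∘ ⇔-sym (h-kernel x y)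

      g : Chain.Carrier m → C5.Carrier
      g = ext f ∘ section

      g∘h≗ext : ∀ t → g (h t) ≡ ext f t
      g∘h≗ext t = to (h≡⇔ext≡ (section (h t)) t) (h∘section (h t))

      g-injective : ∀ a b → g a ≡ g b → a ≡ b
      g-injective a b ga≡gb =
        trans (sym (h∘section a)) (trans (from (h≡⇔ext≡ _ _) ga≡gb) (h∘section b))

      image : ∀ y → Gen f y ⇔ ∃ λ c → g c ≡ y
      image y = mk⇔
        (λ y∈Gen → let t , ext-t≡y = Gen⇒ext-image y∈Gen in h t , trans (g∘h≗ext t) ext-t≡y)
        (λ (c , g-c≡y) → subst (Gen f) g-c≡y (ext∈Gen (section c)))

      open Factorisation {termAlgebra n} {chain m} {chain 4} {h} {g} g∘h≗ext
      open Surjective section h∘section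

      g-hom : IsNelsonHomomorphism (chain m) (chain 4) g
      g-hom = isNelsonHomomorphism ext-isNelsonHomomorphism h-hom

lemma4p5 : (n : ℕ) → 1 ≤ n → (f : Fin n → C5.Carrier) →
    (i : ℕ) → 2 ≤ i → i ≤ 5 →
      SubIso f (i ∸ 1) ⇔ QuotIso f (i ∸ 1)
lemma4p5 n _ f i _ _ = mk⇔ (subIso⇒quotIso f (i ∸ 1)) (quotIso⇒subIso f (i ∸ 1))
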